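{- Let $n$ be a positive integer. If $U(n)$ is not cyclic and has elements of order $\frac{\varphi(n)}{2}$, then there exists $x\in U(n)$ of order $\frac{\varphi(n)}{2}$ such that $x^i\not\equiv -1\pmod n$ for all $1\leq i<\frac{\varphi(n)}{2}$.
   Context: $U(n)$ denotes the multiplicative group of units of $\mathbb{Z}/n\mathbb{Z}$ and $\varphi$ is Euler's totient function. -}

module Defs where

open import Data.Nat using (ℕ; zero; suc; _^_; _<_; _≤_; _∸_; NonZero)
open import Data.Nat.DivMod using (_%_)
open import Data.Nat.Coprimality using (Coprime; coprime?)
open import Data.List using (length; filter; upTo)
open import Data.Product using (_×_; ∃-syntax)
open import Relation.Binary.PropositionalEquality using (_≡_)
open import Relation.Nullary using (¬_)

-- Euler's totient: number of 0 ≤ a < n with gcd(a,n) = 1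
-- (φ(1) = 1 since gcd(0,1) = 1).
φ : ℕ → ℕ
φ n = length (filter (λ a → coprime? a n) (upTo n))

IsUnit : (n : ℕ) → ℕ → Set
IsUnit n a = a < n × Coprime a n

HasOrder : (n : ℕ) .{{_ : NonZero n}} → ℕ → ℕ → Set
HasOrder n x k =
  1 ≤ k × (x ^ k) % n ≡ 1 % n × (∀ j → 1 ≤ j → j < k → ¬ ((x ^ j) % n ≡ 1 % n))

IsCyclicU : (n : ℕ) .{{_ : NonZero n}} → Set
IsCyclicU n = ∃[ g ] (IsUnit n g × HasOrder n g (φ n))

{-# OPTIONS --safe #-}
-- Let y have order m = φ(n)/2. If no power y^i with 0 < i < m is -1, take x = y. Otherwise
-- m = 2i, and since 2m ≤ φ(n) ≤ 2m + 1 the subgroup H = ⟨y⟩ has index two, so H contains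
-- every square. Pick z ∉ H and write z² = y^j. For odd j, z y^(-(j-1)/2) squares to y and has
-- order 2m = φ(n), so U(n) would be cyclic; hence j is even and t = z y^(-j/2) is an
-- involution outside H. If i is odd, x = y t works: (y t)^q = ±1 forces q = i, and
-- (y t)^i = -t ≠ ±1. If i were even, w = y^(i/2) would satisfy w² = -1, so 4 ∤ n; then
-- 1 + t can be halved modulo n, giving an idempotent e with 2e = 1 + t, and u = e w + 1 - e
-- satisfies u² = -t, which puts t into H.
module Submission where

open import Defs
open import Data.Nat as ℕ using (ℕ; zero; suc; NonZero; z≤n; s≤s)
import Data.Nat.Properties as ℕP
import Data.Nat.DivMod as ℕD
import Data.Nat.Divisibility as ℕ∣
import Data.Nat.Tactic.RingSolver as ℕ-Solver
open import Data.Nat.Coprimality using (Coprime; coprime?; coprime-Bézout)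
import Data.Nat.GCD as GCD
open import Data.Integer as ℤ using (ℤ; +_; _+_; _*_; -_; _-_; 0ℤ; 1ℤ; -1ℤ; _⊖_)
import Data.Integer.Properties as ℤP
open import Data.Integer.DivMod using (_%ℕ_; _/ℕ_; a≡a%ℕn+[a/ℕn]*n; n%ℕd<d)
open import Data.Integer.Divisibility.Signed
open import Data.Integer.Tactic.RingSolver using (solve-∀)
open import Data.Product using (_×_; _,_; ∃-syntax; proj₁; proj₂)
open import Data.List using (List; []; _∷_; _++_; length; filter; upTo; applyUpTo)
open import Data.List.Properties using (length-applyUpTo; length-++)
open import Data.List.Relation.Binary.Subset.Propositional using (_⊆_)
import Data.List.Relation.Unary.All as All
open import Data.List.Relation.Unary.All.Properties using (¬All⇒Any¬)
open import Data.List.Relation.Unary.AllPairs using (_∷_)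
open import Data.List.Relation.Unary.Any using (here; there)
open import Data.Sum using (_⊎_; inj₁; inj₂; [_,_]′)
open import Function using (_∘_; id)
open import Relation.Nullary.Decidable using (map′)
open import Relation.Binary.Definitions using (Decidable; tri<; tri≈; tri>)
open import Data.List.Membership.Propositional using (_∈_; find)
open import Data.List.Membership.Propositional.Properties
  using (∈-∃++; ∈-++⁻; ∈-++⁺ˡ; ∈-++⁺ʳ; ∈-filter⁺; ∈-filter⁻; ∈-upTo⁺; ∈-upTo⁻; ∈-applyUpTo⁺; ∈-applyUpTo⁻)
open import Data.List.Membership.DecPropositional ℕ._≟_ using (_∈?_)
open import Data.List.Relation.Unary.Unique.Propositional using (Unique)
import Data.List.Relation.Unary.Unique.Propositional.Properties as Unique
import Relation.Binary.Reasoning.Setoid as SetoidReasoning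
open import Relation.Binary.Bundles using (Setoid)
open import Relation.Binary.PropositionalEquality
open import Relation.Nullary using (¬_; yes; no; _×-dec_)
open import Data.Empty using (⊥; ⊥-elim)

Unique⇒length≤ : ∀ {A : Set} {xs ys : List A} → Unique xs → xs ⊆ ys → length xs ℕ.≤ length ys
Unique⇒length≤ {xs = []}     _ _ = z≤n
Unique⇒length≤ {xs = x ∷ xs} (x∉xs ∷ unique) x∷xs⊆ys with ∈-∃++ (x∷xs⊆ys (here refl))
... | us , vs , refl = begin
  suc (length xs)             ≤⟨ s≤s (Unique⇒length≤ unique xs⊆us++vs) ⟩
  suc (length (us ++ vs))     ≡⟨ cong suc (length-++ us) ⟩
  suc (length us ℕ.+ length vs) ≡⟨ ℕP.+-suc (length us) (length vs) ⟨
  length us ℕ.+ length (x ∷ vs) ≡⟨ length-++ us ⟨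
  length (us ++ x ∷ vs)       ∎
  where
  open ℕP.≤-Reasoning
  xs⊆us++vs : xs ⊆ us ++ vs
  xs⊆us++vs {z} z∈xs with ∈-++⁻ us (x∷xs⊆ys (there z∈xs))
  ... | inj₁ z∈us         = ∈-++⁺ˡ z∈us
  ... | inj₂ (here z≡x)   = ⊥-elim (All.lookup x∉xs z∈xs (sym z≡x))
  ... | inj₂ (there z∈vs) = ∈-++⁺ʳ us z∈vs

+-double-injective : ∀ {a b} → a ℕ.+ a ≡ b ℕ.+ b → a ≡ b
+-double-injective {zero}  {zero}  _  = refl
+-double-injective {zero}  {suc _} ()
+-double-injective {suc _} {zero}  ()
+-double-injective {suc a} {suc b} 2a+2≡2b+2 = cong suc (+-double-injective
  (ℕP.suc-injective (trans (sym (ℕP.+-suc a a)) (trans (ℕP.suc-injective 2a+2≡2b+2) (ℕP.+-suc b b)))))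

even⊎odd : ∀ k → (∃[ h ] k ≡ h ℕ.+ h) ⊎ (∃[ h ] k ≡ suc (h ℕ.+ h))
even⊎odd zero    = inj₁ (0 , refl)
even⊎odd (suc k) with even⊎odd k
... | inj₁ (h , k≡2h)   = inj₂ (h , cong suc k≡2h)
... | inj₂ (h , k≡2h+1) = inj₁ (suc h , cong suc (trans k≡2h+1 (sym (ℕP.+-suc h h))))

h*2≡h+h : ∀ h → h ℕ.* 2 ≡ h ℕ.+ h
h*2≡h+h = ℕ-Solver.solve-∀

2∣h+h : ∀ h → 2 ℕ∣.∣ h ℕ.+ h
2∣h+h h = ℕ∣.divides h (sym (h*2≡h+h h))

coprime-to-even⇒odd : ∀ {a b h} → Coprime a b → b ≡ h ℕ.+ h → ∃[ s ] a ≡ suc (s ℕ.+ s)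
coprime-to-even⇒odd {a} {b} {h} coprime b≡2h with even⊎odd a
... | inj₂ a-odd = a-odd
... | inj₁ (s , a≡2s)
  with coprime (subst (2 ℕ∣.∣_) (sym a≡2s) (2∣h+h s) , subst (2 ℕ∣.∣_) (sym b≡2h) (2∣h+h h))
...   | ()

4∤q*4+r : ∀ q r .{{_ : NonZero r}} → r ℕ.< 4 → ¬ 4 ℕ∣.∣ q ℕ.* 4 ℕ.+ r
4∤q*4+r q r r<4 4∣q*4+r = ℕP.<⇒≱ r<4 (ℕ∣.∣⇒≤ (ℕ∣.∣m+n∣m⇒∣n 4∣q*4+r (ℕ∣.divides q refl)))

4∤x*x+1 : ∀ x → ¬ 4 ℕ∣.∣ x ℕ.* x ℕ.+ 1
4∤x*x+1 x 4∣x*x+1 with even⊎odd x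
... | inj₁ (h , refl) = 4∤q*4+r (h ℕ.* h) 1 (s≤s (s≤s z≤n)) (subst (4 ℕ∣.∣_) (identity h) 4∣x*x+1)
  where
  identity : ∀ h → (h ℕ.+ h) ℕ.* (h ℕ.+ h) ℕ.+ 1 ≡ h ℕ.* h ℕ.* 4 ℕ.+ 1
  identity = ℕ-Solver.solve-∀
... | inj₂ (h , refl) = 4∤q*4+r (h ℕ.* h ℕ.+ h) 2 (s≤s (s≤s (s≤s z≤n))) (subst (4 ℕ∣.∣_) (identity h) 4∣x*x+1)
  where
  identity : ∀ h → suc (h ℕ.+ h) ℕ.* suc (h ℕ.+ h) ℕ.+ 1 ≡ (h ℕ.* h ℕ.+ h) ℕ.* 4 ℕ.+ 2
  identity = ℕ-Solver.solve-∀

half-bounds : ∀ p → p ℕ./ 2 ℕ.+ p ℕ./ 2 ℕ.≤ p × p ℕ.≤ suc (p ℕ./ 2 ℕ.+ p ℕ./ 2)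
half-bounds p = subst (ℕ._≤ p) [p/2]*2 (ℕD.m/n*n≤m p 2) , subst (p ℕ.≤_) (cong suc [p/2]*2) p≤1+[p/2]*2
  where
  [p/2]*2 : p ℕ./ 2 ℕ.* 2 ≡ p ℕ./ 2 ℕ.+ p ℕ./ 2
  [p/2]*2 = h*2≡h+h (p ℕ./ 2)
  p≤1+[p/2]*2 : p ℕ.≤ suc (p ℕ./ 2 ℕ.* 2)
  p≤1+[p/2]*2 = subst (ℕ._≤ suc (p ℕ./ 2 ℕ.* 2)) (sym (ℕD.m≡m%n+[m/n]*n p 2))
                  (ℕP.+-monoˡ-≤ (p ℕ./ 2 ℕ.* 2) (ℕP.<⇒≤pred (ℕD.m%n<n p 2)))

module Modulo (n : ℕ) .{{_ : NonZero n}} where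

  open import Data.Integer using (_^_)

  ^-distribʳ-* : ∀ a b e → (a * b) ^ e ≡ a ^ e * b ^ e
  ^-distribʳ-* a b zero    = refl
  ^-distribʳ-* a b (suc e) = trans (cong ((a * b) *_) (^-distribʳ-* a b e)) (identity a b (a ^ e) (b ^ e))
    where
    identity : ∀ a b c d → (a * b) * (c * d) ≡ (a * c) * (b * d)
    identity = solve-∀

  ^-double : ∀ a e → (a * a) ^ e ≡ a ^ (e ℕ.+ e)
  ^-double a e = trans (^-distribʳ-* a a e) (sym (ℤP.^-distribˡ-+-* a e e))

  infix 4 _≋_
  record _≋_ (a b : ℤ) : Set where
    constructor mk≋
    field n∣a-b : + n ∣ a - b
  open _≋_ public

  ≋-intro : ∀ {a b c} → a - b ≡ c → + n ∣ c → a ≋ b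
  ≋-intro a-b≡c n∣c = mk≋ (subst (+ n ∣_) (sym a-b≡c) n∣c)

  ≡⇒≋ : ∀ {a b} → a ≡ b → a ≋ b
  ≡⇒≋ {a} refl = ≋-intro (ℤP.+-inverseʳ a) (divides 0ℤ refl)

  ≋-sym : ∀ {a b} → a ≋ b → b ≋ a
  ≋-sym {a} {b} (mk≋ d) = ≋-intro (identity a b) (∣m⇒∣-m d)
    where
    identity : ∀ a b → b - a ≡ - (a - b)
    identity = solve-∀

  ≋-trans : ∀ {a b c} → a ≋ b → b ≋ c → a ≋ c
  ≋-trans {a} {b} {c} (mk≋ d) (mk≋ e) = ≋-intro (identity a b c) (∣m∣n⇒∣m+n d e)
    where
    identity : ∀ a b c → a - c ≡ (a - b) + (b - c)
    identity = solve-∀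

  ≋-setoid : Setoid _ _
  ≋-setoid = record
    { Carrier = ℤ ; _≈_ = _≋_
    ; isEquivalence = record { refl = ≡⇒≋ refl ; sym = ≋-sym ; trans = ≋-trans } }

  module ≋-Reasoning = SetoidReasoning ≋-setoid

  +-cong : ∀ {a b c d} → a ≋ b → c ≋ d → a + c ≋ b + d
  +-cong {a} {b} {c} {d} (mk≋ p) (mk≋ q) = ≋-intro (identity a b c d) (∣m∣n⇒∣m+n p q)
    where
    identity : ∀ a b c d → (a + c) - (b + d) ≡ (a - b) + (c - d)
    identity = solve-∀

  *-cong : ∀ {a b c d} → a ≋ b → c ≋ d → a * c ≋ b * d
  *-cong {a} {b} {c} {d} (mk≋ p) (mk≋ q) =
    ≋-intro (identity a b c d) (∣m∣n⇒∣m+n (∣m⇒∣m*n c p) (∣n⇒∣m*n b q))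
    where
    identity : ∀ a b c d → a * c - b * d ≡ (a - b) * c + b * (c - d)
    identity = solve-∀

  *-congˡ : ∀ c {a b} → a ≋ b → c * a ≋ c * b
  *-congˡ c a≋b = *-cong (≡⇒≋ {c} refl) a≋b

  *-congʳ : ∀ c {a b} → a ≋ b → a * c ≋ b * c
  *-congʳ c a≋b = *-cong a≋b (≡⇒≋ {c} refl)

  -‿cong : ∀ {a b} → a ≋ b → - a ≋ - b
  -‿cong {a} {b} (mk≋ p) = ≋-intro (identity a b) (∣m⇒∣-m p)
    where
    identity : ∀ a b → - a - - b ≡ - (a - b)
    identity = solve-∀

  ^-congˡ : ∀ e {a b} → a ≋ b → a ^ e ≋ b ^ e
  ^-congˡ zero    a≋b = ≡⇒≋ refl
  ^-congˡ (suc e) a≋b = *-cong a≋b (^-congˡ e a≋b)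

  n≋0 : + n ≋ 0ℤ
  n≋0 = ≋-intro (ℤP.+-identityʳ (+ n)) ∣-refl

  res : ℤ → ℕ
  res a = a %ℕ n

  res<n : ∀ a → res a ℕ.< n
  res<n a = n%ℕd<d a n

  res≋ : ∀ a → + res a ≋ a
  res≋ a = ≋-sym (≋-intro (identity a (+ res a) (a /ℕ n) (a≡a%ℕn+[a/ℕn]*n a n)) (divides (a /ℕ n) refl))
    where
    identity : ∀ a r q → a ≡ r + q * + n → a - r ≡ q * + n
    identity a r q refl = lemma r q (+ n)
      where
      lemma : ∀ r q n → (r + q * n) - r ≡ q * n
      lemma = solve-∀

  ≋-<n⇒≡ : ∀ {x y} → x ℕ.< n → y ℕ.< n → + x ≋ + y → x ≡ y
  ≋-<n⇒≡ {x} {y} x<n y<n (mk≋ n∣x-y) with ℤ.∣ x ⊖ y ∣ in eq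
  ... | zero  = ℤP.+-injective (ℤP.i-j≡0⇒i≡j (+ x) (+ y)
                  (trans (ℤP.m-n≡m⊖n x y) (ℤP.∣i∣≡0⇒i≡0 eq)))
  ... | suc d = ⊥-elim (ℕ∣.>⇒∤ d<n (subst (n ℕ∣.∣_) eq n∣∣x⊖y∣))
    where
    n∣∣x⊖y∣ : n ℕ∣.∣ ℤ.∣ x ⊖ y ∣
    n∣∣x⊖y∣ = ∣⇒∣ᵤ (subst (+ n ∣_) (ℤP.m-n≡m⊖n x y) n∣x-y)
    d<n : suc d ℕ.< n
    d<n = subst (ℕ._< n) eq (ℕP.≤-<-trans (ℤP.∣m⊝n∣≤m⊔n x y) (ℕP.⊔-lub x<n y<n))

  res-cong : ∀ {a b} → a ≋ b → res a ≡ res b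
  res-cong {a} {b} a≋b = ≋-<n⇒≡ (res<n a) (res<n b) (≋-trans (res≋ a) (≋-trans a≋b (≋-sym (res≋ b))))

  res-injective : ∀ {a b} → res a ≡ res b → a ≋ b
  res-injective {a} {b} eq = ≋-trans (≋-sym (res≋ a)) (≋-trans (≡⇒≋ (cong +_ eq)) (res≋ b))

  res-+ : ∀ {x} → x ℕ.< n → res (+ x) ≡ x
  res-+ = ℕD.m<n⇒m%n≡m

  pos-^ : ∀ x e → + (x ℕ.^ e) ≡ (+ x) ^ e
  pos-^ x zero    = refl
  pos-^ x (suc e) = trans (ℤP.pos-* x (x ℕ.^ e)) (cong (+ x *_) (pos-^ x e))

  ^%≡%⇒≋ : ∀ x e b → (x ℕ.^ e) ℕ.% n ≡ b ℕ.% n → (+ x) ^ e ≋ + b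
  ^%≡%⇒≋ x e b eq = ≋-trans (≡⇒≋ (sym (pos-^ x e))) (res-injective eq)

  ≋⇒^%≡% : ∀ x e b → (+ x) ^ e ≋ + b → (x ℕ.^ e) ℕ.% n ≡ b ℕ.% n
  ≋⇒^%≡% x e b eq = res-cong (≋-trans (≡⇒≋ (pos-^ x e)) eq)

  n∸1≋-1 : + (n ℕ.∸ 1) ≋ -1ℤ
  n∸1≋-1 = ≋-intro (identity (n ℕ.∸ 1) (ℕP.suc-pred n)) ∣-refl
    where
    identity : ∀ k → suc k ≡ n → + k - -1ℤ ≡ + n
    identity k refl = ℤP.+-comm (+ k) 1ℤ

  Order : ℤ → ℕ → Set
  Order a k = 1 ℕ.≤ k × a ^ k ≋ 1ℤ × (∀ j → 1 ℕ.≤ j → j ℕ.< k → ¬ a ^ j ≋ 1ℤ)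

  HasOrder⇒Order : ∀ {x k} → HasOrder n x k → Order (+ x) k
  HasOrder⇒Order {x} {k} (1≤k , x^k , minimal) =
    1≤k , ^%≡%⇒≋ x k 1 x^k , λ j 1≤j j<k x^j → minimal j 1≤j j<k (≋⇒^%≡% x j 1 x^j)

  Order-resp : ∀ {a b k} → a ≋ b → Order a k → Order b k
  Order-resp {k = k} a≋b (1≤k , a^k , minimal) =
    1≤k , ≋-trans (^-congˡ k (≋-sym a≋b)) a^k ,
    λ j 1≤j j<k b^j → minimal j 1≤j j<k (≋-trans (^-congˡ j a≋b) b^j)

  Order⇒HasOrder : ∀ {x k} → Order (+ x) k → HasOrder n x k
  Order⇒HasOrder {x} {k} (1≤k , x^k , minimal) =
    1≤k , ≋⇒^%≡% x k 1 x^k , λ j 1≤j j<k x^j → minimal j 1≤j j<k (^%≡%⇒≋ x j 1 x^j)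

  record Unit (a : ℤ) : Set where
    constructor invertible
    field
      inverse  : ℤ
      inverseʳ : a * inverse ≋ 1ℤ

  Unit-1 : Unit 1ℤ
  Unit-1 = invertible 1ℤ (≡⇒≋ refl)

  Unit-* : ∀ {a b} → Unit a → Unit b → Unit (a * b)
  Unit-* {a} {b} (invertible c ac≋1) (invertible d bd≋1) = invertible (c * d) (begin
    (a * b) * (c * d) ≡⟨ identity a b c d ⟩
    (a * c) * (b * d) ≈⟨ *-cong ac≋1 bd≋1 ⟩
    1ℤ * 1ℤ           ≡⟨⟩
    1ℤ                ∎)
    where
    open ≋-Reasoning
    identity : ∀ a b c d → (a * b) * (c * d) ≡ (a * c) * (b * d)
    identity = solve-∀

  Unit-^ : ∀ {a} e → Unit a → Unit (a ^ e)
  Unit-^ zero    _      = Unit-1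
  Unit-^ (suc e) unit-a = Unit-* unit-a (Unit-^ e unit-a)

  Order⇒Unit : ∀ {a k} → Order a k → Unit a
  Order⇒Unit {a} {k} (1≤k , a^k , _) =
    invertible (a ^ (k ℕ.∸ 1)) (≋-trans (≡⇒≋ (cong (a ^_) (ℕP.m+[n∸m]≡n 1≤k))) a^k)

  *-cancelˡ : ∀ {c a b} → Unit c → c * a ≋ c * b → a ≋ b
  *-cancelˡ {c} {a} {b} (invertible d cd≋1) ca≋cb = begin
    a               ≈⟨ ≡⇒≋ (ℤP.*-identityˡ a) ⟨
    1ℤ * a          ≈⟨ *-congʳ a cd≋1 ⟨
    (c * d) * a     ≡⟨ identity c d a ⟩
    d * (c * a)     ≈⟨ *-congˡ d ca≋cb ⟩
    d * (c * b)     ≡⟨ identity c d b ⟨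
    (c * d) * b     ≈⟨ *-congʳ b cd≋1 ⟩
    1ℤ * b          ≡⟨ ℤP.*-identityˡ b ⟩
    b               ∎
    where
    open ≋-Reasoning
    identity : ∀ c d a → (c * d) * a ≡ d * (c * a)
    identity = solve-∀

  Unit⇒Coprime : ∀ {a} → Unit a → Coprime (res a) n
  Unit⇒Coprime {a} (invertible b ab≋1) {i} (i∣r , i∣n) = ℕ∣.∣1⇒≡1 (∣⇒∣ᵤ i∣1)
    where
    rb≋1 : + res a * b ≋ 1ℤ
    rb≋1 = ≋-trans (*-congʳ b (res≋ a)) ab≋1
    i∣rb : + i ∣ + res a * b
    i∣rb = ∣m⇒∣m*n b (∣ᵤ⇒∣ {+ i} {+ res a} i∣r)
    i∣rb-1 : + i ∣ + res a * b - 1ℤ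
    i∣rb-1 = ∣-trans (∣ᵤ⇒∣ {+ i} {+ n} i∣n) (n∣a-b rb≋1)
    identity : ∀ x → x - (x - 1ℤ) ≡ 1ℤ
    identity = solve-∀
    i∣1 : + i ∣ 1ℤ
    i∣1 = subst (+ i ∣_) (identity (+ res a * b)) (∣m∣n⇒∣m-n i∣rb i∣rb-1)

  Coprime⇒Unit : ∀ {x} → Coprime x n → Unit (+ x)
  Coprime⇒Unit {x} coprime with coprime-Bézout coprime
  ... | GCD.Bézout.+- u v 1+vn≡ux = invertible (+ u) (≋-intro xu-1≡vn (∣n⇒∣m*n (+ v) ∣-refl))
    where
    open ≡-Reasoning
    identity : ∀ k → 1ℤ + k - 1ℤ ≡ k
    identity = solve-∀
    xu-1≡vn : + x * + u - 1ℤ ≡ + v * + n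
    xu-1≡vn = begin
      + x * + u - 1ℤ          ≡⟨ cong (_- 1ℤ) (trans (ℤP.*-comm (+ x) (+ u)) (sym (ℤP.pos-* u x))) ⟩
      + (u ℕ.* x) - 1ℤ        ≡⟨ cong (λ k → + k - 1ℤ) (sym 1+vn≡ux) ⟩
      + (1 ℕ.+ v ℕ.* n) - 1ℤ  ≡⟨ cong (_- 1ℤ) (ℤP.pos-+ 1 (v ℕ.* n)) ⟩
      1ℤ + + (v ℕ.* n) - 1ℤ   ≡⟨ identity (+ (v ℕ.* n)) ⟩
      + (v ℕ.* n)             ≡⟨ ℤP.pos-* v n ⟩
      + v * + n               ∎
  ... | GCD.Bézout.-+ u v 1+ux≡vn =
    invertible (- + u) (≋-intro x[-u]-1≡-vn (∣m⇒∣-m (∣n⇒∣m*n (+ v) ∣-refl)))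
    where
    open ≡-Reasoning
    identity : ∀ x u → x * - u - 1ℤ ≡ - (1ℤ + u * x)
    identity = solve-∀
    x[-u]-1≡-vn : + x * - + u - 1ℤ ≡ - (+ v * + n)
    x[-u]-1≡-vn = begin
      + x * - + u - 1ℤ      ≡⟨ identity (+ x) (+ u) ⟩
      - (1ℤ + + u * + x)    ≡⟨ cong (λ k → - (1ℤ + k)) (sym (ℤP.pos-* u x)) ⟩
      - (1ℤ + + (u ℕ.* x))  ≡⟨ cong -_ (sym (ℤP.pos-+ 1 (u ℕ.* x))) ⟩
      - + (1 ℕ.+ u ℕ.* x)   ≡⟨ cong (λ k → - + k) 1+ux≡vn ⟩
      - + (v ℕ.* n)         ≡⟨ cong -_ (ℤP.pos-* v n) ⟩
      - (+ v * + n)         ∎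

  units : List ℕ
  units = filter (λ a → coprime? a n) (upTo n)

  units-unique : Unique units
  units-unique = Unique.filter⁺ (λ a → coprime? a n) (Unique.upTo⁺ n)

  ∈units⇒Unit : ∀ {x} → x ∈ units → Unit (+ x)
  ∈units⇒Unit x∈units = Coprime⇒Unit (proj₂ (∈-filter⁻ (λ a → coprime? a n) {xs = upTo n} x∈units))

  ∈units⇒<n : ∀ {x} → x ∈ units → x ℕ.< n
  ∈units⇒<n x∈units = ∈-upTo⁻ (proj₁ (∈-filter⁻ (λ a → coprime? a n) {xs = upTo n} x∈units))

  Unit⇒res∈units : ∀ {a} → Unit a → res a ∈ units
  Unit⇒res∈units {a} unit-a =
    ∈-filter⁺ (λ a → coprime? a n) {xs = upTo n} (∈-upTo⁺ (res<n a)) (Unit⇒Coprime unit-a)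

  Order⇒IsCyclicU : ∀ {g} → Unit g → Order g (φ n) → IsCyclicU n
  Order⇒IsCyclicU {g} unit-g order-g =
    res g , (res<n g , Unit⇒Coprime unit-g) , Order⇒HasOrder (Order-resp (≋-sym (res≋ g)) order-g)

  residue-witness : ∀ {k} →
    ∃[ x ] (Unit x × Order x k × (∀ q → 1 ℕ.≤ q → q ℕ.< k → ¬ x ^ q ≋ -1ℤ)) →
    ∃[ x ] (IsUnit n x × HasOrder n x k ×
            (∀ q → 1 ℕ.≤ q → q ℕ.< k → ¬ (x ℕ.^ q) ℕ.% n ≡ (n ℕ.∸ 1) ℕ.% n))
  residue-witness (x , unit-x , order-x , no-power≋-1) =
    res x , (res<n x , Unit⇒Coprime unit-x) , Order⇒HasOrder (Order-resp (≋-sym (res≋ x)) order-x) ,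
    λ q 1≤q q<k r^q≡n∸1 → no-power≋-1 q 1≤q q<k (begin
      x ^ q          ≈⟨ ^-congˡ q (res≋ x) ⟨
      (+ res x) ^ q  ≈⟨ ^%≡%⇒≋ (res x) q (n ℕ.∸ 1) r^q≡n∸1 ⟩
      + (n ℕ.∸ 1)    ≈⟨ n∸1≋-1 ⟩
      -1ℤ            ∎)
    where open ≋-Reasoning

  square-Unit⇒Unit : ∀ {u a} → u * u ≋ a → Unit a → Unit u
  square-Unit⇒Unit {u} {a} u*u≋a (invertible b ab≋1) = invertible (u * b) (begin
    u * (u * b)  ≡⟨ ℤP.*-assoc u u b ⟨
    u * u * b    ≈⟨ *-congʳ b u*u≋a ⟩
    a * b        ≈⟨ ab≋1 ⟩
    1ℤ           ∎)
    where open ≋-Reasoning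

  involution-idempotent : ∀ {t g} → t * t ≋ 1ℤ → (1ℤ + t) * (g + g - 1ℤ) ≋ 0ℤ →
    ((1ℤ + t) * g) * ((1ℤ + t) * g) ≋ (1ℤ + t) * g × (1ℤ + t) * g + (1ℤ + t) * g ≋ 1ℤ + t
  involution-idempotent {t} {g} (mk≋ n∣t²-1) (mk≋ n∣[1+t][2g-1]) =
    ≋-intro (identity₁ t g) (∣m∣n⇒∣m+n (∣n⇒∣m*n g n∣[1+t][2g-1]) (∣n⇒∣m*n (g * g) n∣t²-1)) ,
    ≋-intro (identity₂ t g) n∣[1+t][2g-1]
    where
    identity₁ : ∀ t g → ((1ℤ + t) * g) * ((1ℤ + t) * g) - (1ℤ + t) * g
                      ≡ g * ((1ℤ + t) * (g + g - 1ℤ) - 0ℤ) + (g * g) * (t * t - 1ℤ)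
    identity₁ = solve-∀
    identity₂ : ∀ t g → ((1ℤ + t) * g + (1ℤ + t) * g) - (1ℤ + t) ≡ (1ℤ + t) * (g + g - 1ℤ) - 0ℤ
    identity₂ = solve-∀

  -- Modulo the two coprime factors of n on which the idempotent e is 1 resp. 0,
  -- the element u is w resp. 1 and - t is -1 resp. 1.
  idempotent-twist-square : ∀ {e w t} → e * e ≋ e → e + e ≋ 1ℤ + t → w * w ≋ -1ℤ →
                            (e * w + (1ℤ - e)) * (e * w + (1ℤ - e)) ≋ - t
  idempotent-twist-square {e} {w} {t} (mk≋ n∣e²-e) (mk≋ n∣2e-1-t) (mk≋ n∣w²+1) =
    ≋-intro (identity e w t)
      (∣m∣n⇒∣m-n (∣m∣n⇒∣m-n (∣n⇒∣m*n (e * e) n∣w²+1) (∣n⇒∣m*n (w + w) n∣e²-e)) n∣2e-1-t)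
    where
    identity : ∀ e w t → (e * w + (1ℤ - e)) * (e * w + (1ℤ - e)) - - t
                       ≡ (e * e) * (w * w - -1ℤ) - (w + w) * (e * e - e) - ((e + e) - (1ℤ + t))
    identity = solve-∀

  √-1⇒4∤n : ∀ {w} → w * w ≋ -1ℤ → ¬ 4 ℕ∣.∣ n
  √-1⇒4∤n {w} w*w≋-1 4∣n =
    4∤x*x+1 r (ℕ∣.∣-trans 4∣n (∣⇒∣ᵤ (subst (+ n ∣_) r*r+1 (n∣a-b r*r≋-1))))
    where
    r : ℕ
    r = res w
    r*r≋-1 : + r * + r ≋ -1ℤ
    r*r≋-1 = ≋-trans (*-cong (res≋ w) (res≋ w)) w*w≋-1
    r*r+1 : + r * + r - -1ℤ ≡ + (r ℕ.* r ℕ.+ 1)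
    r*r+1 = trans (cong (_+ 1ℤ) (sym (ℤP.pos-* r r))) (sym (ℤP.pos-+ (r ℕ.* r) 1))

  -- g is 1/2 modulo the odd part 2g - 1 of n; for even n this needs t to be odd.
  half-of-one-plus-involution : ¬ 4 ℕ∣.∣ n → ∀ {t} → t * t ≋ 1ℤ →
                                ∃[ g ] (1ℤ + t) * (g + g - 1ℤ) ≋ 0ℤ
  half-of-one-plus-involution 4∤n {t} t*t≋1 with even⊎odd n
  ... | inj₂ (h , n≡2h+1) = 1ℤ + + h , (begin
    (1ℤ + t) * ((1ℤ + + h) + (1ℤ + + h) - 1ℤ)  ≡⟨ cong ((1ℤ + t) *_) (identity (+ h)) ⟩
    (1ℤ + t) * (1ℤ + (+ h + + h))             ≡⟨ cong (λ k → (1ℤ + t) * + k) n≡2h+1 ⟨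
    (1ℤ + t) * + n                            ≈⟨ *-congˡ (1ℤ + t) n≋0 ⟩
    (1ℤ + t) * 0ℤ                             ≡⟨ ℤP.*-zeroʳ (1ℤ + t) ⟩
    0ℤ                                        ∎)
    where
    open ≋-Reasoning
    identity : ∀ h → (1ℤ + h) + (1ℤ + h) - 1ℤ ≡ 1ℤ + (h + h)
    identity = solve-∀
  ... | inj₁ (h , n≡2h) with even⊎odd h
  ...   | inj₁ (k , refl) = ⊥-elim (4∤n (ℕ∣.divides k (trans n≡2h (identity k))))
    where
    identity : ∀ k → (k ℕ.+ k) ℕ.+ (k ℕ.+ k) ≡ k ℕ.* 4
    identity = ℕ-Solver.solve-∀
  ...   | inj₂ (k , h≡2k+1) with coprime-to-even⇒odd {h = h} (Unit⇒Coprime {t} (invertible t t*t≋1)) n≡2h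
  ...     | s , res≡2s+1 = 1ℤ + + k , (begin
    (1ℤ + t) * ((1ℤ + + k) + (1ℤ + + k) - 1ℤ)  ≡⟨ cong ((1ℤ + t) *_) 2g-1≡h ⟩
    (1ℤ + t) * + h                            ≈⟨ *-congʳ (+ h) (+-cong (≡⇒≋ {1ℤ} refl) (res≋ t)) ⟨
    (1ℤ + + res t) * + h                      ≡⟨ cong (λ r → (1ℤ + + r) * + h) res≡2s+1 ⟩
    (1ℤ + (1ℤ + (+ s + + s))) * + h           ≡⟨ identity₂ (+ s) (+ h) ⟩
    (1ℤ + + s) * (+ h + + h)                  ≡⟨ cong ((1ℤ + + s) *_) (cong +_ (sym n≡2h)) ⟩
    (1ℤ + + s) * + n                          ≈⟨ *-congˡ (1ℤ + + s) n≋0 ⟩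
    (1ℤ + + s) * 0ℤ                           ≡⟨ ℤP.*-zeroʳ (1ℤ + + s) ⟩
    0ℤ                                        ∎)
    where
    open ≋-Reasoning
    identity₁ : ∀ k → (1ℤ + k) + (1ℤ + k) - 1ℤ ≡ 1ℤ + (k + k)
    identity₁ = solve-∀
    2g-1≡h : (1ℤ + + k) + (1ℤ + + k) - 1ℤ ≡ + h
    2g-1≡h = trans (identity₁ (+ k)) (cong +_ (sym h≡2k+1))
    identity₂ : ∀ s h → (1ℤ + (1ℤ + (s + s))) * h ≡ (1ℤ + s) * (h + h)
    identity₂ = solve-∀

  neg-involution-is-square : ∀ {w t} → w * w ≋ -1ℤ → t * t ≋ 1ℤ → ∃[ u ] u * u ≋ - t
  neg-involution-is-square {w} {t} w*w≋-1 t*t≋1 =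
    e * w + (1ℤ - e) , idempotent-twist-square {e} {w} {t} (proj₁ idempotent) (proj₂ idempotent) w*w≋-1
    where
    half : ∃[ g ] (1ℤ + t) * (g + g - 1ℤ) ≋ 0ℤ
    half = half-of-one-plus-involution (√-1⇒4∤n {w} w*w≋-1) {t} t*t≋1
    e : ℤ
    e = (1ℤ + t) * proj₁ half
    idempotent : e * e ≋ e × e + e ≋ 1ℤ + t
    idempotent = involution-idempotent {t} {proj₁ half} t*t≋1 (proj₂ half)

  module CyclicSubgroup {y : ℤ} {m : ℕ} (order-y : Order y m) where

    private
      1≤m : 1 ℕ.≤ m
      1≤m = proj₁ order-y
      y^m≋1 : y ^ m ≋ 1ℤ
      y^m≋1 = proj₁ (proj₂ order-y)
      minimal : ∀ j → 1 ℕ.≤ j → j ℕ.< m → ¬ y ^ j ≋ 1ℤ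
      minimal = proj₂ (proj₂ order-y)

    instance
      m-nonZero : NonZero m
      m-nonZero = ℕ.>-nonZero 1≤m

    y^-+ : ∀ a b → y ^ (a ℕ.+ b) ≡ y ^ a * y ^ b
    y^-+ = ℤP.^-distribˡ-+-* y

    y^[m+e]≋y^e : ∀ e → y ^ (m ℕ.+ e) ≋ y ^ e
    y^[m+e]≋y^e e = begin
      y ^ (m ℕ.+ e)  ≡⟨ y^-+ m e ⟩
      y ^ m * y ^ e  ≈⟨ *-congʳ (y ^ e) y^m≋1 ⟩
      1ℤ * y ^ e     ≡⟨ ℤP.*-identityˡ (y ^ e) ⟩
      y ^ e          ∎
      where open ≋-Reasoning

    y^[qm+e]≋y^e : ∀ q e → y ^ (q ℕ.* m ℕ.+ e) ≋ y ^ e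
    y^[qm+e]≋y^e zero    e = ≡⇒≋ refl
    y^[qm+e]≋y^e (suc q) e = ≋-trans (≡⇒≋ (cong (y ^_) (ℕP.+-assoc m (q ℕ.* m) e)))
                                     (≋-trans (y^[m+e]≋y^e (q ℕ.* m ℕ.+ e)) (y^[qm+e]≋y^e q e))

    y^%≋y^ : ∀ e → y ^ (e ℕ.% m) ≋ y ^ e
    y^%≋y^ e = ≋-trans (≋-sym (y^[qm+e]≋y^e (e ℕ./ m) (e ℕ.% m)))
                       (≡⇒≋ (cong (y ^_) (trans (ℕP.+-comm _ (e ℕ.% m)) (sym (ℕD.m≡m%n+[m/n]*n e m)))))

    y^≋1⇒≡m : ∀ j → 1 ℕ.≤ j → j ℕ.< m ℕ.+ m → y ^ j ≋ 1ℤ → j ≡ m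
    y^≋1⇒≡m j 1≤j j<2m y^j≋1 with ℕP.<-cmp j m
    ... | tri< j<m _ _ = ⊥-elim (minimal j 1≤j j<m y^j≋1)
    ... | tri≈ _ j≡m _ = j≡m
    ... | tri> _ _ m<j = ⊥-elim (minimal (j ℕ.∸ m) (ℕP.m<n⇒0<n∸m m<j) j∸m<m (begin
      y ^ (j ℕ.∸ m)          ≈⟨ y^[m+e]≋y^e (j ℕ.∸ m) ⟨
      y ^ (m ℕ.+ (j ℕ.∸ m))  ≡⟨ cong (y ^_) (ℕP.m+[n∸m]≡n (ℕP.<⇒≤ m<j)) ⟩
      y ^ j                  ≈⟨ y^j≋1 ⟩
      1ℤ                     ∎))
      where
      open ≋-Reasoning
      j∸m<m : j ℕ.∸ m ℕ.< m
      j∸m<m = ℕP.+-cancelˡ-< m (j ℕ.∸ m) m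
                (subst (ℕ._< m ℕ.+ m) (sym (ℕP.m+[n∸m]≡n (ℕP.<⇒≤ m<j))) j<2m)

    Unit-y^ : ∀ e → Unit (y ^ e)
    Unit-y^ e = Unit-^ e (Order⇒Unit order-y)

    y^-distinct : ∀ {i j} → i ℕ.< j → j ℕ.< m → ¬ y ^ i ≋ y ^ j
    y^-distinct {i} {j} i<j j<m y^i≋y^j = minimal (j ℕ.∸ i) (ℕP.m<n⇒0<n∸m i<j)
      (ℕP.≤-<-trans (ℕP.m∸n≤m j i) j<m)
      (≋-sym (*-cancelˡ (Unit-y^ i) (begin
        y ^ i * 1ℤ               ≡⟨ ℤP.*-identityʳ (y ^ i) ⟩
        y ^ i                    ≈⟨ y^i≋y^j ⟩
        y ^ j                    ≡⟨ cong (y ^_) (ℕP.m+[n∸m]≡n (ℕP.<⇒≤ i<j)) ⟨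
        y ^ (i ℕ.+ (j ℕ.∸ i))    ≡⟨ y^-+ i (j ℕ.∸ i) ⟩
        y ^ i * y ^ (j ℕ.∸ i)    ∎)))
      where open ≋-Reasoning

    y⁻¹ : ℤ
    y⁻¹ = y ^ (m ℕ.∸ 1)

    y^e*y⁻¹^e≋1 : ∀ e → y ^ e * y⁻¹ ^ e ≋ 1ℤ
    y^e*y⁻¹^e≋1 e = begin
      y ^ e * y⁻¹ ^ e  ≡⟨ ^-distribʳ-* y y⁻¹ e ⟨
      (y * y⁻¹) ^ e    ≈⟨ ^-congˡ e (Unit.inverseʳ (Order⇒Unit order-y)) ⟩
      1ℤ ^ e           ≡⟨ ℤP.^-zeroˡ e ⟩
      1ℤ               ∎
      where open ≋-Reasoning

    infix 4 _∼_
    record _∼_ (c d : ℤ) : Set where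
      constructor mk∼
      field
        exponent : ℕ
        c≋d*y^e  : c ≋ d * y ^ exponent

    ≋⇒∼ : ∀ {c d} → c ≋ d → c ∼ d
    ≋⇒∼ {c} {d} c≋d = mk∼ 0 (≋-trans c≋d (≡⇒≋ (sym (ℤP.*-identityʳ d))))

    ∼-respˡ : ∀ {a b d} → a ≋ b → b ∼ d → a ∼ d
    ∼-respˡ a≋b (mk∼ e b≋) = mk∼ e (≋-trans a≋b b≋)

    y^∼1 : ∀ e → y ^ e ∼ 1ℤ
    y^∼1 e = mk∼ e (≡⇒≋ (sym (ℤP.*-identityˡ (y ^ e))))

    ∼-sym : ∀ {c d} → c ∼ d → d ∼ c
    ∼-sym {c} {d} (mk∼ e c≋dy^e) = mk∼ ((m ℕ.∸ 1) ℕ.* e) (begin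
      d                          ≡⟨ ℤP.*-identityʳ d ⟨
      d * 1ℤ                     ≈⟨ *-congˡ d (y^e*y⁻¹^e≋1 e) ⟨
      d * (y ^ e * y⁻¹ ^ e)      ≡⟨ ℤP.*-assoc d (y ^ e) (y⁻¹ ^ e) ⟨
      d * y ^ e * y⁻¹ ^ e        ≈⟨ *-congʳ (y⁻¹ ^ e) c≋dy^e ⟨
      c * y⁻¹ ^ e                ≡⟨ cong (c *_) (ℤP.^-*-assoc y (m ℕ.∸ 1) e) ⟩
      c * y ^ ((m ℕ.∸ 1) ℕ.* e)  ∎)
      where open ≋-Reasoning

    ∼-* : ∀ {a b c d} → a ∼ b → c ∼ d → a * c ∼ b * d
    ∼-* {a} {b} {c} {d} (mk∼ e a≋) (mk∼ f c≋) = mk∼ (e ℕ.+ f) (begin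
      a * c                      ≈⟨ *-cong a≋ c≋ ⟩
      (b * y ^ e) * (d * y ^ f)  ≡⟨ identity b d (y ^ e) (y ^ f) ⟩
      (b * d) * (y ^ e * y ^ f)  ≡⟨ cong ((b * d) *_) (y^-+ e f) ⟨
      (b * d) * y ^ (e ℕ.+ f)    ∎)
      where
      open ≋-Reasoning
      identity : ∀ b d u v → (b * u) * (d * v) ≡ (b * d) * (u * v)
      identity = solve-∀

    ∼-trans : ∀ {a b c} → a ∼ b → b ∼ c → a ∼ c
    ∼-trans {a} {b} {c} (mk∼ e a≋by^e) (mk∼ f b≋cy^f) = mk∼ (f ℕ.+ e) (begin
      a                    ≈⟨ a≋by^e ⟩
      b * y ^ e            ≈⟨ *-congʳ (y ^ e) b≋cy^f ⟩
      c * y ^ f * y ^ e    ≡⟨ ℤP.*-assoc c (y ^ f) (y ^ e) ⟩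
      c * (y ^ f * y ^ e)  ≡⟨ cong (c *_) (y^-+ f e) ⟨
      c * y ^ (f ℕ.+ e)    ∎)
      where open ≋-Reasoning

    coset : ℤ → List ℕ
    coset d = applyUpTo (λ e → res (d * y ^ e)) m

    length-coset : ∀ d → length (coset d) ≡ m
    length-coset d = length-applyUpTo (λ e → res (d * y ^ e)) m

    ∼⇒res∈coset : ∀ {c d} → c ∼ d → res c ∈ coset d
    ∼⇒res∈coset {c} {d} (mk∼ e c≋dy^e) =
      subst (_∈ coset d) (res-cong (≋-trans (*-congˡ d (y^%≋y^ e)) (≋-sym c≋dy^e)))
            (∈-applyUpTo⁺ (λ e → res (d * y ^ e)) (ℕD.m%n<n e m))

    ∈coset⇒∼ : ∀ {x d} → x ∈ coset d → + x ∼ d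
    ∈coset⇒∼ {d = d} x∈coset with ∈-applyUpTo⁻ (λ e → res (d * y ^ e)) x∈coset
    ... | e , _ , refl = mk∼ e (res≋ (d * y ^ e))

    coset-unique : ∀ {d} → Unit d → Unique (coset d)
    coset-unique unit-d = Unique.applyUpTo⁺₁ _ m
      λ i<j j<m res≡ → y^-distinct i<j j<m (*-cancelˡ unit-d (res-injective res≡))

    coset⊆units : ∀ {d} → Unit d → coset d ⊆ units
    coset⊆units {d} unit-d x∈coset with ∈-applyUpTo⁻ (λ e → res (d * y ^ e)) x∈coset
    ... | e , _ , refl = Unit⇒res∈units (Unit-* unit-d (Unit-y^ e))

    infix 4 _∼?_
    _∼?_ : Decidable _∼_
    c ∼? d = map′ (λ r∈coset → ∼-respˡ (≋-sym (res≋ c)) (∈coset⇒∼ {d = d} r∈coset))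
                  (∼⇒res∈coset {c} {d}) (res c ∈? coset d)

    ∼⇒∈coset : ∀ {x d} → x ℕ.< n → + x ∼ d → x ∈ coset d
    ∼⇒∈coset {d = d} x<n x∼d = subst (_∈ coset d) (res-+ x<n) (∼⇒res∈coset x∼d)

    no-three-cosets : φ n ℕ.≤ suc (m ℕ.+ m) → 2 ℕ.≤ m → ∀ {a b c} → Unit a → Unit b → Unit c →
                      ¬ a ∼ b → ¬ a ∼ c → ¬ b ∼ c → ⊥
    no-three-cosets φ≤2m+1 2≤m {a} {b} {c} unit-a unit-b unit-c a≁b a≁c b≁c =
      ℕP.<⇒≱ φ<3m (Unique⇒length≤ unique cosets⊆units)
      where
      cosets : List ℕ
      cosets = coset a ++ coset b ++ coset c
      common⇒∼ : ∀ {x d e} → x ∈ coset d → x ∈ coset e → d ∼ e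
      common⇒∼ x∈d x∈e = ∼-trans (∼-sym (∈coset⇒∼ x∈d)) (∈coset⇒∼ x∈e)
      unique : Unique cosets
      unique = Unique.++⁺ (coset-unique unit-a)
        (Unique.++⁺ (coset-unique unit-b) (coset-unique unit-c) λ (x∈b , x∈c) → b≁c (common⇒∼ x∈b x∈c))
        λ { (x∈a , x∈b++c) → case-++ x∈b++c (a≁b ∘ common⇒∼ x∈a) (a≁c ∘ common⇒∼ x∈a) }
        where
        case-++ : ∀ {x} {B : Set} → x ∈ coset b ++ coset c → (x ∈ coset b → B) → (x ∈ coset c → B) → B
        case-++ x∈b++c f g with ∈-++⁻ (coset b) x∈b++c
        ... | inj₁ x∈b = f x∈b
        ... | inj₂ x∈c = g x∈c
      cosets⊆units : cosets ⊆ units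
      cosets⊆units x∈ with ∈-++⁻ (coset a) x∈
      ... | inj₁ x∈a = coset⊆units unit-a x∈a
      ... | inj₂ x∈b++c with ∈-++⁻ (coset b) x∈b++c
      ...   | inj₁ x∈b = coset⊆units unit-b x∈b
      ...   | inj₂ x∈c = coset⊆units unit-c x∈c
      length-cosets : length cosets ≡ m ℕ.+ (m ℕ.+ m)
      length-cosets = trans (length-++ (coset a))
        (cong₂ ℕ._+_ (length-coset a) (trans (length-++ (coset b)) (cong₂ ℕ._+_ (length-coset b) (length-coset c))))
      φ<3m : φ n ℕ.< length cosets
      φ<3m = subst (φ n ℕ.<_) (sym length-cosets)
               (ℕP.≤-trans (s≤s φ≤2m+1) (ℕP.+-monoˡ-≤ (m ℕ.+ m) 2≤m))

    outside-subgroup : m ℕ.< φ n → ∃[ z ] (Unit z × ¬ z ∼ 1ℤ)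
    outside-subgroup m<φ with All.all? (λ x → + x ∼? 1ℤ) units
    ... | yes all∼1 =
      ⊥-elim (ℕP.<⇒≱ m<φ (subst (φ n ℕ.≤_) (length-coset 1ℤ) (Unique⇒length≤ units-unique units⊆H)))
      where
      units⊆H : units ⊆ coset 1ℤ
      units⊆H x∈units = ∼⇒∈coset (∈units⇒<n x∈units) (All.lookup all∼1 x∈units)
    ... | no ¬all∼1 with find (¬All⇒Any¬ (λ x → + x ∼? 1ℤ) units ¬all∼1)
    ...   | x , x∈units , x≁1 = + x , ∈units⇒Unit x∈units , x≁1

    module IndexTwo (φ≤2m+1 : φ n ℕ.≤ suc (m ℕ.+ m)) (2≤m : 2 ℕ.≤ m)
                    {z} (unit-z : Unit z) (z≁1 : ¬ z ∼ 1ℤ) where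

      ∼1⊎∼z : ∀ {u} → Unit u → u ∼ 1ℤ ⊎ u ∼ z
      ∼1⊎∼z {u} unit-u with u ∼? 1ℤ | u ∼? z
      ... | yes u∼1 | _       = inj₁ u∼1
      ... | no _    | yes u∼z = inj₂ u∼z
      ... | no u≁1  | no u≁z  =
        ⊥-elim (no-three-cosets φ≤2m+1 2≤m Unit-1 unit-z unit-u
                 (z≁1 ∘ ∼-sym) (u≁1 ∘ ∼-sym) (u≁z ∘ ∼-sym))

      φ≤m+m : φ n ℕ.≤ m ℕ.+ m
      φ≤m+m = subst (φ n ℕ.≤_) length-H++zH (Unique⇒length≤ units-unique units⊆H++zH)
        where
        units⊆H++zH : units ⊆ coset 1ℤ ++ coset z
        units⊆H++zH {x} x∈units with ∼1⊎∼z (∈units⇒Unit x∈units)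
        ... | inj₁ x∼1 = ∈-++⁺ˡ (∼⇒∈coset (∈units⇒<n x∈units) x∼1)
        ... | inj₂ x∼z = ∈-++⁺ʳ (coset 1ℤ) (∼⇒∈coset (∈units⇒<n x∈units) x∼z)
        length-H++zH : length (coset 1ℤ ++ coset z) ≡ m ℕ.+ m
        length-H++zH = trans (length-++ (coset 1ℤ)) (cong₂ ℕ._+_ (length-coset 1ℤ) (length-coset z))

      z*z∼1 : z * z ∼ 1ℤ
      z*z∼1 with ∼1⊎∼z (Unit-* unit-z unit-z)
      ... | inj₁ z*z∈H             = z*z∈H
      ... | inj₂ (mk∼ e z*z≋z*y^e) =
        ⊥-elim (z≁1 (mk∼ e (≋-trans (*-cancelˡ unit-z z*z≋z*y^e) (≡⇒≋ (sym (ℤP.*-identityˡ (y ^ e)))))))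

      square∼1 : ∀ {u} → Unit u → u * u ∼ 1ℤ
      square∼1 unit-u with ∼1⊎∼z unit-u
      ... | inj₁ u∼1 = ∼-* u∼1 u∼1
      ... | inj₂ u∼z = ∼-trans (∼-* u∼z u∼z) z*z∼1

    z*y⁻¹^b∼z : ∀ z b → z * y⁻¹ ^ b ∼ z
    z*y⁻¹^b∼z z b = mk∼ ((m ℕ.∸ 1) ℕ.* b) (≡⇒≋ (cong (z *_) (ℤP.^-*-assoc y (m ℕ.∸ 1) b)))

    halve-exponent : ∀ {z} r b → z * z ≋ y ^ (r ℕ.+ (b ℕ.+ b)) → (z * y⁻¹ ^ b) * (z * y⁻¹ ^ b) ≋ y ^ r
    halve-exponent {z} r b z*z≋y^[r+2b] = begin
      (z * y⁻¹ ^ b) * (z * y⁻¹ ^ b)                     ≡⟨ identity₁ z (y⁻¹ ^ b) ⟩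
      (z * z) * (y⁻¹ ^ b * y⁻¹ ^ b)                     ≈⟨ *-congʳ (y⁻¹ ^ b * y⁻¹ ^ b) z*z≋y^[r+2b] ⟩
      y ^ (r ℕ.+ (b ℕ.+ b)) * (y⁻¹ ^ b * y⁻¹ ^ b)       ≡⟨ cong (_* (y⁻¹ ^ b * y⁻¹ ^ b)) y^[r+2b] ⟩
      (y ^ r * (y ^ b * y ^ b)) * (y⁻¹ ^ b * y⁻¹ ^ b)   ≡⟨ identity₂ (y ^ r) (y ^ b) (y⁻¹ ^ b) ⟩
      y ^ r * ((y ^ b * y⁻¹ ^ b) * (y ^ b * y⁻¹ ^ b))   ≈⟨ *-congˡ (y ^ r) (*-cong y^b*y⁻¹^b≋1 y^b*y⁻¹^b≋1) ⟩
      y ^ r * (1ℤ * 1ℤ)                                 ≡⟨ ℤP.*-identityʳ (y ^ r) ⟩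
      y ^ r                                             ∎
      where
      open ≋-Reasoning
      y^b*y⁻¹^b≋1 : y ^ b * y⁻¹ ^ b ≋ 1ℤ
      y^b*y⁻¹^b≋1 = y^e*y⁻¹^e≋1 b
      y^[r+2b] : y ^ (r ℕ.+ (b ℕ.+ b)) ≡ y ^ r * (y ^ b * y ^ b)
      y^[r+2b] = trans (y^-+ r (b ℕ.+ b)) (cong (y ^ r *_) (y^-+ b b))
      identity₁ : ∀ z u → (z * u) * (z * u) ≡ (z * z) * (u * u)
      identity₁ = solve-∀
      identity₂ : ∀ a u v → (a * (u * u)) * (v * v) ≡ a * ((u * v) * (u * v))
      identity₂ = solve-∀

    square-root-order : ∀ {w} → w * w ≋ y → ¬ w ^ m ≋ 1ℤ → Order w (m ℕ.+ m)
    square-root-order {w} w*w≋y w^m≉1 = ℕP.≤-trans 1≤m (ℕP.m≤m+n m m) , w^[q+q]≋1 m y^m≋1 , minimal-w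
      where
      w^[q+q]≋1 : ∀ q → y ^ q ≋ 1ℤ → w ^ (q ℕ.+ q) ≋ 1ℤ
      w^[q+q]≋1 q y^q≋1 = ≋-trans (≡⇒≋ (sym (^-double w q))) (≋-trans (^-congˡ q w*w≋y) y^q≋1)
      minimal-w : ∀ q → 1 ℕ.≤ q → q ℕ.< m ℕ.+ m → ¬ w ^ q ≋ 1ℤ
      minimal-w q 1≤q q<2m w^q≋1 = w^m≉1 (subst (λ k → w ^ k ≋ 1ℤ) (y^≋1⇒≡m q 1≤q q<2m y^q≋1) w^q≋1)
        where
        open ≋-Reasoning
        y^q≋1 : y ^ q ≋ 1ℤ
        y^q≋1 = begin
          y ^ q            ≈⟨ ^-congˡ q w*w≋y ⟨
          (w * w) ^ q      ≡⟨ ^-distribʳ-* w w q ⟩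
          w ^ q * w ^ q    ≈⟨ *-cong w^q≋1 w^q≋1 ⟩
          1ℤ               ∎

    module Twist {t} (t*t≋1 : t * t ≋ 1ℤ) (t≁1 : ¬ t ∼ 1ℤ)
                 {i d} (m≡i+i : m ≡ i ℕ.+ i) (i≡2d+1 : i ≡ suc (d ℕ.+ d)) (y^i≋-1 : y ^ i ≋ -1ℤ) where

      t^[k+k]≋1 : ∀ k → t ^ (k ℕ.+ k) ≋ 1ℤ
      t^[k+k]≋1 k = ≋-trans (≡⇒≋ (sym (^-double t k))) (≋-trans (^-congˡ k t*t≋1) (≡⇒≋ (ℤP.^-zeroˡ k)))

      [yt]^i≋-t : (y * t) ^ i ≋ - t
      [yt]^i≋-t = begin
        (y * t) ^ i                 ≡⟨ ^-distribʳ-* y t i ⟩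
        y ^ i * t ^ i               ≡⟨ cong (λ k → y ^ i * t ^ k) i≡2d+1 ⟩
        y ^ i * (t * t ^ (d ℕ.+ d)) ≈⟨ *-cong y^i≋-1 (*-congˡ t (t^[k+k]≋1 d)) ⟩
        -1ℤ * (t * 1ℤ)              ≡⟨ identity t ⟩
        - t                         ∎
        where
        open ≋-Reasoning
        identity : ∀ t → -1ℤ * (t * 1ℤ) ≡ - t
        identity = solve-∀

      power≋±1⇒≡i : ∀ q {s} → 1 ℕ.≤ q → q ℕ.< m → (y * t) ^ q ≋ s → s * s ≋ 1ℤ → q ≡ i
      power≋±1⇒≡i q {s} 1≤q q<m [yt]^q≋s s*s≋1 = +-double-injective (trans
        (y^≋1⇒≡m (q ℕ.+ q) (ℕP.≤-trans 1≤q (ℕP.m≤m+n q q)) (ℕP.+-mono-< q<m q<m) y^[q+q]≋1) m≡i+i)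
        where
        open ≋-Reasoning
        y^[q+q]≋1 : y ^ (q ℕ.+ q) ≋ 1ℤ
        y^[q+q]≋1 = begin
          y ^ (q ℕ.+ q)                        ≡⟨ ℤP.*-identityʳ _ ⟨
          y ^ (q ℕ.+ q) * 1ℤ                   ≈⟨ *-congˡ (y ^ (q ℕ.+ q)) (t^[k+k]≋1 q) ⟨
          y ^ (q ℕ.+ q) * t ^ (q ℕ.+ q)        ≡⟨ ^-distribʳ-* y t (q ℕ.+ q) ⟨
          (y * t) ^ (q ℕ.+ q)                  ≡⟨ ℤP.^-distribˡ-+-* (y * t) q q ⟩
          (y * t) ^ q * (y * t) ^ q            ≈⟨ *-cong [yt]^q≋s [yt]^q≋s ⟩
          s * s                                ≈⟨ s*s≋1 ⟩
          1ℤ                                   ∎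

      power≋±1⇒t≋∓1 : ∀ q {s} → 1 ℕ.≤ q → q ℕ.< m → (y * t) ^ q ≋ s → s * s ≋ 1ℤ → t ≋ - s
      power≋±1⇒t≋∓1 q {s} 1≤q q<m [yt]^q≋s s*s≋1 = begin
        t              ≡⟨ ℤP.neg-involutive t ⟨
        - - t          ≈⟨ -‿cong [yt]^i≋-t ⟨
        - (y * t) ^ i  ≡⟨ cong (λ k → - (y * t) ^ k) (power≋±1⇒≡i q 1≤q q<m [yt]^q≋s s*s≋1) ⟨
        - (y * t) ^ q  ≈⟨ -‿cong [yt]^q≋s ⟩
        - s            ∎
        where open ≋-Reasoning

      order : Order (y * t) m
      order = 1≤m , [yt]^m≋1 , minimal-yt
        where
        [yt]^m≋1 : (y * t) ^ m ≋ 1ℤ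
        [yt]^m≋1 = ≋-trans (≡⇒≋ (^-distribʳ-* y t m))
          (≋-trans (*-cong y^m≋1 (subst (λ k → t ^ k ≋ 1ℤ) (sym m≡i+i) (t^[k+k]≋1 i))) (≡⇒≋ refl))
        minimal-yt : ∀ q → 1 ℕ.≤ q → q ℕ.< m → ¬ (y * t) ^ q ≋ 1ℤ
        minimal-yt q 1≤q q<m [yt]^q≋1 =
          t≁1 (∼-respˡ (≋-trans (power≋±1⇒t≋∓1 q 1≤q q<m [yt]^q≋1 (≡⇒≋ refl)) (≋-sym y^i≋-1)) (y^∼1 i))

      no-power≋-1 : ∀ q → 1 ℕ.≤ q → q ℕ.< m → ¬ (y * t) ^ q ≋ -1ℤ
      no-power≋-1 q 1≤q q<m [yt]^q≋-1 = t≁1 (≋⇒∼ (power≋±1⇒t≋∓1 q 1≤q q<m [yt]^q≋-1 (≡⇒≋ refl)))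

  module NonCyclic (non-cyclic : ¬ IsCyclicU n) {y m} (order-y : Order y m)
                   (2m≤φ : m ℕ.+ m ℕ.≤ φ n) (φ≤2m+1 : φ n ℕ.≤ suc (m ℕ.+ m))
                   {i} (1≤i : 1 ℕ.≤ i) (i<m : i ℕ.< m) (y^i≋-1 : y ^ i ≋ -1ℤ) where

    open CyclicSubgroup order-y

    -1∼1 : -1ℤ ∼ 1ℤ
    -1∼1 = ∼-respˡ (≋-sym y^i≋-1) (y^∼1 i)

    m≡i+i : m ≡ i ℕ.+ i
    m≡i+i = sym (y^≋1⇒≡m (i ℕ.+ i) (ℕP.≤-trans 1≤i (ℕP.m≤m+n i i)) (ℕP.+-mono-< i<m i<m)
                 (≋-trans (≡⇒≋ (y^-+ i i)) (*-cong y^i≋-1 y^i≋-1)))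

    outside : ∃[ z ] (Unit z × ¬ z ∼ 1ℤ)
    outside = outside-subgroup (ℕP.<-≤-trans (ℕP.m<m+n m (ℕP.≤-trans 1≤i (ℕP.<⇒≤ i<m))) 2m≤φ)

    z : ℤ
    z = proj₁ outside

    unit-z : Unit z
    unit-z = proj₁ (proj₂ outside)

    z≁1 : ¬ z ∼ 1ℤ
    z≁1 = proj₂ (proj₂ outside)

    open IndexTwo φ≤2m+1 (ℕP.≤-trans (s≤s 1≤i) i<m) unit-z z≁1

    j : ℕ
    j = _∼_.exponent z*z∼1

    z*z≋y^j : z * z ≋ y ^ j
    z*z≋y^j = ≋-trans (_∼_.c≋d*y^e z*z∼1) (≡⇒≋ (ℤP.*-identityˡ (y ^ j)))

    odd-j⇒cyclic : ∀ {b} → j ≡ suc (b ℕ.+ b) → IsCyclicU n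
    odd-j⇒cyclic {b} j≡2b+1 = Order⇒IsCyclicU unit-w
      (subst (Order w) (sym (ℕP.≤-antisym φ≤m+m 2m≤φ)) (square-root-order w*w≋y w^m≉1))
      where
      w : ℤ
      w = z * y⁻¹ ^ b
      unit-w : Unit w
      unit-w = Unit-* unit-z (Unit-^ b (Unit-y^ (m ℕ.∸ 1)))
      w*w≋y : w * w ≋ y
      w*w≋y = ≋-trans (halve-exponent {z} 1 b (≋-trans z*z≋y^j (≡⇒≋ (cong (y ^_) j≡2b+1))))
                      (≡⇒≋ (ℤP.^-identityʳ y))
      w^m≉1 : ¬ w ^ m ≋ 1ℤ
      w^m≉1 w^m≋1 = proj₂ (proj₂ order-y) i 1≤i i<m (begin
        y ^ i              ≈⟨ ^-congˡ i w*w≋y ⟨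
        (w * w) ^ i        ≡⟨ ^-double w i ⟩
        w ^ (i ℕ.+ i)      ≡⟨ cong (w ^_) m≡i+i ⟨
        w ^ m              ≈⟨ w^m≋1 ⟩
        1ℤ                 ∎)
        where open ≋-Reasoning

    j-even : ∃[ b ] j ≡ b ℕ.+ b
    j-even = [ id , (λ (b , j≡2b+1) → ⊥-elim (non-cyclic (odd-j⇒cyclic {b} j≡2b+1))) ]′ (even⊎odd j)

    t : ℤ
    t = z * y⁻¹ ^ proj₁ j-even

    t*t≋1 : t * t ≋ 1ℤ
    t*t≋1 = halve-exponent {z} 0 (proj₁ j-even) (≋-trans z*z≋y^j (≡⇒≋ (cong (y ^_) (proj₂ j-even))))

    t≁1 : ¬ t ∼ 1ℤ
    t≁1 t∼1 = z≁1 (∼-trans (∼-sym (z*y⁻¹^b∼z z (proj₁ j-even))) t∼1)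

    even-i⇒t∼1 : ∀ {d} → i ≡ d ℕ.+ d → t ∼ 1ℤ
    even-i⇒t∼1 {d} i≡2d = ∼-respˡ t≋-1*-t (∼-* -1∼1 -t∼1)
      where
      v*v≋-1 : y ^ d * y ^ d ≋ -1ℤ
      v*v≋-1 = ≋-trans (≡⇒≋ (trans (sym (y^-+ d d)) (cong (y ^_) (sym i≡2d)))) y^i≋-1
      root : ∃[ u ] u * u ≋ - t
      root = neg-involution-is-square {y ^ d} {t} v*v≋-1 t*t≋1
      u : ℤ
      u = proj₁ root
      u*u≋-t : u * u ≋ - t
      u*u≋-t = proj₂ root
      identity₁ : ∀ t → - t * - t ≡ t * t
      identity₁ = solve-∀
      identity₂ : ∀ t → t ≡ -1ℤ * - t
      identity₂ = solve-∀
      unit-u : Unit u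
      unit-u = square-Unit⇒Unit {u} {a = - t} u*u≋-t
                 (invertible (- t) (≋-trans (≡⇒≋ (identity₁ t)) t*t≋1))
      -t∼1 : - t ∼ 1ℤ
      -t∼1 = ∼-respˡ (≋-sym u*u≋-t) (square∼1 unit-u)
      t≋-1*-t : t ≋ -1ℤ * - t
      t≋-1*-t = ≡⇒≋ (identity₂ t)

    i-odd : ∃[ d ] i ≡ suc (d ℕ.+ d)
    i-odd = [ (λ (d , i≡2d) → ⊥-elim (t≁1 (even-i⇒t∼1 {d} i≡2d))) , id ]′ (even⊎odd i)

    open Twist {t} t*t≋1 t≁1 {i} {proj₁ i-odd} m≡i+i (proj₂ i-odd) y^i≋-1

    twisted-generator : ∃[ x ] (Unit x × Order x m × (∀ q → 1 ℕ.≤ q → q ℕ.< m → ¬ x ^ q ≋ -1ℤ))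
    twisted-generator = y * t , Unit-* (Order⇒Unit order-y) (invertible t t*t≋1) , order , no-power≋-1

open import Data.Nat using (ℕ; _^_; _<_; _≤_; _∸_; NonZero)
open import Data.Nat.DivMod using (_/_; _%_)
open import Data.Product using (_×_; ∃-syntax)
open import Relation.Binary.PropositionalEquality using (_≡_)
open import Relation.Nullary using (¬_)

mainTheorem5 : (n : ℕ) .{{_ : NonZero n}} →
    ¬ IsCyclicU n →
    ∃[ y ] (IsUnit n y × HasOrder n y (φ n / 2)) →
    ∃[ x ] (IsUnit n x × HasOrder n x (φ n / 2) ×
      (∀ i → 1 ≤ i → i < φ n / 2 → ¬ ((x ^ i) % n ≡ (n ∸ 1) % n)))
mainTheorem5 n non-cyclic (y , unit-y , order-y)
  with ℕP.anyUpTo? (λ i → 1 ℕ.≤? i ×-dec (y ^ i) % n ℕ.≟ (n ∸ 1) % n) (φ n / 2)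
... | no ¬∃i = y , unit-y , order-y , λ i 1≤i i<m y^i≡-1 → ¬∃i (i , i<m , 1≤i , y^i≡-1)
... | yes (i , i<m , 1≤i , y^i≡-1) = residue-witness twisted-generator
  where
  open Modulo n
  open NonCyclic non-cyclic (HasOrder⇒Order order-y)
                 (proj₁ (half-bounds (φ n))) (proj₂ (half-bounds (φ n)))
                 1≤i i<m (≋-trans (^%≡%⇒≋ y i (n ∸ 1) y^i≡-1) n∸1≋-1)
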